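{- Let $g$ be a generic enumeration of $\mathcal{A}$, let $\mathcal{G}=g^{ -1}(\mathcal{A})$ and let $D_\mathcal{G}$ be the atomic diagram of $\mathcal{G}$. Then for every computable $\mathbb{N}$-formula $\varphi$ in normal form, \[(\mathbb N,D_\mathcal{G})\models\varphi\iff\exists p\subset g\,[\,p\Vdash_\mathcal{A}\varphi\,].\]
   Context: Let $\tau$ be a countable relational vocabulary with $=,\neq$ and $\mathcal{A}$ a $\tau$-structure with universe $\omega$. Fix an effective enumeration $(\phi^{at}_n)$ of atomic $\tau$-formulas with free variables of $\phi^{at}_n$ among $x_0,\dots,x_n$; the atomic diagram of a structure $\mathcal{B}$ with universe $\omega$ is $D_\mathcal{B}=\{n:\mathcal{B}\models\phi^{at}_n[x_i\mapsto i]\}$. $g^{ -1}(\mathcal{A})$ is the structure on $\omega$ with $R^{\mathcal{G}}(\bar a)$ iff $R^\mathcal{A}(g(\bar a))$. $\mathbb{N}$-formulas in normal form: built from atoms $\top,\bot,D(\mathbf n)$ without quantifiers, with $(\mathbb N,X)\models D(\mathbf n)$ iff $n\in X$; $\mathbb{N}$-$\Sigma^p_0$ = finite conjunctions of atoms; $\mathbb{N}$-$\Pi^p_0$ = finite disjunctions of negated atoms; $\mathbb{N}$-$\Sigma^p_1$/$\mathbb{N}$-$\Pi^p_1$ = countable disjunctions of $\mathbb{N}$-$\Sigma^p_0$ / conjunctions of $\mathbb{N}$-$\Pi^p_0$; for $\alpha\ge2$, $\mathbb{N}$-$\Sigma^p_\alpha$ = $\bigvee_i(\phi_i\wedge\theta_i)$,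 $\mathbb{N}$-$\Pi^p_\alpha$ = $\bigwedge_i(\phi_i\vee\theta_i)$, $\phi_i\in\mathbb{N}$-$\Sigma^p_{\beta_i}$, $\theta_i\in\mathbb{N}$-$\Pi^p_{\beta_i}$, $0<\beta_i<\alpha$. Computable $\mathbb{N}$-formulas are those given by indices (levels via notations in Kleene's $\mathcal O$, disjunctions/conjunctions over c.e. sets of indices). $neg(\varphi)$ swaps each atom with its negation and $\bigvee\leftrightarrow\bigwedge$, $\wedge\leftrightarrow\vee$ recursively. Forcing conditions: finite tuples $p=(p_0,\dots,p_{k-1})$ of distinct natural numbers, ordered by extension; $p\subset g$ means $p$ is an initial segment of $g$. Forcing $\Vdash_\mathcal{A}$: $p\Vdash\top$, $p\not\Vdash\bot$; $p\Vdash D(\mathbf n)$ iff all variables $x_i$ of $\phi^{at}_n$ satisfy $i<k$ and $\mathcal{A}\models\phi^{at}_n[x_i\mapsto p_i]$; a finite conjunction of atoms is forced iff each conjunct is; $\bigvee_i\phi_i\in\mathbb{N}$-$\Sigma^p_1$ is forced iff some $\phi_i$ is; $\bigvee_i(\phi_i\wedge\theta_i)\in\mathbb{N}$-$\Sigma^p_\alpha$ ($\alpha\ge2$) is forced iff for some $i$ both are forced; an $\mathbb{N}$-$\Pi^p_\alpha$ formula $\varphi$ is forced by $p$ iff no $q\supseteq p$ forces $neg(\varphi)$. A generic enumeration of $\mathcal{A}$ is a bijection $g:\omega\to\omega$ such that for every computable $\mathbb{N}$-formula $\varphi$ there is $p\subset g$ with $p\Vdash_\mathcal{A}\varphi$ or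 $p\Vdash_\mathcal{A}neg(\varphi)$. -}

module Defs where

open import Data.Nat using (ℕ; zero; suc; _+_; _*_; _^_; _<_; _≤_; _≥_)
open import Data.Bool using (Bool; true; false; if_then_else_)
open import Data.Nat using (_≡ᵇ_)
open import Data.List using (List; []; _∷_; length; _++_; map; upTo)
open import Data.List.Relation.Unary.All using (All)
open import Data.List.Relation.Unary.Any using (Any)
open import Data.List.Relation.Unary.Unique.Propositional using (Unique)
open import Data.Vec using (Vec; toList)
import Data.Vec as Vec
open import Data.Maybe using (Maybe; just; nothing)
open import Data.Product using (Σ; _×_; _,_; ∃)
open import Data.Sum using (_⊎_)
open import Data.Unit using (⊤)
open import Data.Empty using (⊥)
open import Relation.Nullary using (¬_)
open import Relation.Binary.PropositionalEquality using (_≡_; _≢_)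
open import Function.Definitions using (Bijective)

pair : ℕ → ℕ → ℕ
pair a b = 2 ^ a * suc (2 * b)

encList : {A : Set} → (A → ℕ) → List A → ℕ
encList c []       = 0
encList c (x ∷ xs) = suc (pair (c x) (encList c xs))

-- A model of computation: (Minsky) register machines.

data Instr : Set where
  INC   : ℕ → Instr
  JZDEC : ℕ → ℕ → Instr

Prog : Set
Prog = List Instr

record Config : Set where
  constructor cfg
  field
    pc   : ℕ
    regs : ℕ → ℕ
open Config public

lookupI : Prog → ℕ → Maybe Instr
lookupI []       _       = nothing
lookupI (i ∷ is) zero    = just i
lookupI (i ∷ is) (suc n) = lookupI is n

setReg : (ℕ → ℕ) → ℕ → ℕ → (ℕ → ℕ)
setReg s r v x = if x ≡ᵇ r then v else s x

step : Prog → Config → Maybe Config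
step P (cfg k s) with lookupI P k
... | nothing = nothing
... | just (INC r) = just (cfg (suc k) (setReg s r (suc (s r))))
... | just (JZDEC r j) with s r
...   | zero  = just (cfg j s)
...   | suc v = just (cfg (suc k) (setReg s r v))

exec : Prog → ℕ → Config → Config
exec P zero    c = c
exec P (suc n) c with step P c
... | nothing = c
... | just c' = exec P n c'

Halted : Prog → Config → Set
Halted P c = pc c ≥ length P

initCfg : ℕ → Config
initCfg x = cfg 0 (λ r → if r ≡ᵇ 0 then x else 0)

Runs : Prog → ℕ → ℕ → Set
Runs P x y = Σ ℕ λ n → Halted P (exec P n (initCfg x)) × regs (exec P n (initCfg x)) 0 ≡ y

encInstr : Instr → ℕ
encInstr (INC r)     = pair 0 r
encInstr (JZDEC r k) = pair 1 (pair r k)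

encProg : Prog → ℕ
encProg = encList encInstr

Φ : ℕ → ℕ → ℕ → Set
Φ e x y = Σ Prog λ P → encProg P ≡ e × Runs P x y

W : ℕ → ℕ → Set
W e x = Σ ℕ λ y → Φ e x y

-- Kleene's O (notation 1 for 0, 2^a successor, 3·5^e limit)

data O : ℕ → Set
data _<O_ : ℕ → ℕ → Set

data O where
  o-zero : O 1
  o-suc  : ∀ {a} → O a → O (2 ^ a)
  o-lim  : ∀ {e} → (∀ n → Σ ℕ λ y → Φ e n y)
         → (∀ n y y' → Φ e n y → Φ e (suc n) y' → y <O y')
         → O (3 * 5 ^ e)

data _<O_ where
  <O-suc   : ∀ {a} → O a → a <O (2 ^ a)
  <O-lim   : ∀ {e n y} → O (3 * 5 ^ e) → Φ e n y → y <O (3 * 5 ^ e)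
  <O-trans : ∀ {a b c} → a <O b → b <O c → a <O c

-- A normal-form formula is a polarity (Σ or Π) together with a shape:
--   (σ , fin l)        : ⋀ l                 (ℕ-Σ₀, conjunction of atoms)
--   (π , fin l)        : ⋁ {¬a | a ∈ l}      (ℕ-Π₀)
--   (σ , dis1 I f)     : ⋁_i ⋀ (f i)         (ℕ-Σ₁)
--   (π , dis1 I f)     : ⋀_i ⋁ {¬a | a ∈ f i} (ℕ-Π₁)
--   (σ , disα I f h)   : ⋁_i ((σ, f i) ∧ (π, h i))   (ℕ-Σ_α, α ≥ 2)
--   (π , disα I f h)   : ⋀_i ((π, f i) ∨ (σ, h i))   (ℕ-Π_α, α ≥ 2)
-- so that neg (literally: swap atoms with negations, ⋁↔⋀, ∧↔∨) just
-- flips the polarity.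

data NAtom : Set where
  TT FF : NAtom
  D     : ℕ → NAtom

encNAtom : NAtom → ℕ
encNAtom TT    = 0
encNAtom FF    = 1
encNAtom (D n) = suc (suc n)

data Shape : Set₁ where
  fin  : List NAtom → Shape
  dis1 : (I : Set) → (I → List NAtom) → Shape
  disα : (I : Set) → (I → Shape) → (I → Shape) → Shape

data Pol : Set where
  σ π : Pol

NForm : Set₁
NForm = Pol × Shape

flip : Pol → Pol
flip σ = π
flip π = σ

neg : NForm → NForm
neg (b , s) = (flip b , s)

satA : (ℕ → Set) → NAtom → Set
satA X TT    = ⊤
satA X FF    = ⊥
satA X (D n) = X n

sat : (ℕ → Set) → Pol → Shape → Set
sat X σ (fin l)       = All (satA X) l
sat X π (fin l)       = Any (λ a → ¬ satA X a) l
sat X σ (dis1 I f)    = Σ I λ i → All (satA X) (f i)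
sat X π (dis1 I f)    = ∀ i → Any (λ a → ¬ satA X a) (f i)
sat X σ (disα I f h)  = Σ I λ i → sat X σ (f i) × sat X π (h i)
sat X π (disα I f h)  = ∀ i → sat X π (f i) ⊎ sat X σ (h i)

_⊨_ : (ℕ → Set) → NForm → Set
X ⊨ (b , s) = sat X b s

-- Computable ℕ-formulas: indices, with levels given by notations in O.
-- Σ₀/Π₀ index of a finite list l : ⟨0,l⟩ / ⟨1,l⟩;
-- Σ_a / Π_a index (a ≠ 1) with c.e. set W_e : ⟨2,⟨a,e⟩⟩ / ⟨3,⟨a,e⟩⟩.

idx0 : Pol → List NAtom → ℕ
idx0 σ l = pair 0 (encList encNAtom l)
idx0 π l = pair 1 (encList encNAtom l)

idx : Pol → ℕ → ℕ → ℕ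
idx σ a e = pair 2 (pair a e)
idx π a e = pair 3 (pair a e)

-- CF b a i : i is an index of a computable ℕ-Σ_a (b = σ) resp. ℕ-Π_a
-- (b = π) formula in normal form, a ∈ O.
data CF : Pol → ℕ → ℕ → Set where
  cf0 : ∀ b (l : List NAtom) → CF b 1 (idx0 b l)
  -- level 1 (notation 2 = 2^1): ⋁ / ⋀ over W_e of Σ₀ / Π₀ indices
  cf1 : ∀ b e (l : ∀ j → W e j → List NAtom)
      → (∀ j w → j ≡ idx0 b (l j w))
      → CF b 2 (idx b 2 e)
  -- level a with 2 <O a (ordinal ≥ 2): W_e consists of pairs ⟨i,k⟩,
  -- i a Σ_c index, k a Π_c index, with 1 <O c <O a
  cfα : ∀ b a e → O a → 2 <O a
      → (i k c : ∀ j → W e j → ℕ)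
      → (∀ j w → j ≡ pair (i j w) (k j w))
      → (∀ j w → 1 <O c j w)
      → (∀ j w → c j w <O a)
      → (∀ j w → CF σ (c j w) (i j w))
      → (∀ j w → CF π (c j w) (k j w))
      → CF b a (idx b a e)

⟦_⟧ : ∀ {b a i} → CF b a i → Shape
⟦ cf0 b l ⟧ = fin l
⟦ cf1 b e l _ ⟧ = dis1 (Σ ℕ (W e)) (λ { (j , w) → l j w })
⟦ cfα σ a e _ _ i k c _ _ _ dΣ dΠ ⟧ =
  disα (Σ ℕ (W e)) (λ { (j , w) → ⟦ dΣ j w ⟧ }) (λ { (j , w) → ⟦ dΠ j w ⟧ })
-- Π_a: ⋀ (φ_i ∨ θ_k) with φ_i Σ, θ_k Π, stored as ((π,θ_k) ∨ (σ,φ_i))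
⟦ cfα π a e _ _ i k c _ _ _ dΣ dΠ ⟧ =
  disα (Σ ℕ (W e)) (λ { (j , w) → ⟦ dΠ j w ⟧ }) (λ { (j , w) → ⟦ dΣ j w ⟧ })

formula : ∀ {b a i} → CF b a i → NForm
formula {b} d = (b , ⟦ d ⟧)

record Vocab : Set₁ where
  field
    Sym   : Set
    arity : Sym → ℕ
open Vocab public

data Atomic (τ : Vocab) : Set where
  rel : (R : Sym τ) → Vec ℕ (arity τ R) → Atomic τ
  eq  : ℕ → ℕ → Atomic τ
  neq : ℕ → ℕ → Atomic τ

vars : ∀ {τ} → Atomic τ → List ℕ
vars (rel R xs) = toList xs
vars (eq i j)   = i ∷ j ∷ []
vars (neq i j)  = i ∷ j ∷ []

record Structure (τ : Vocab) : Set₁ where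
  field
    interp : (R : Sym τ) → Vec ℕ (arity τ R) → Set
open Structure public

holds : ∀ {τ} → Structure τ → Atomic τ → (ℕ → ℕ) → Set
holds B (rel R xs) s = interp B R (Vec.map s xs)
holds B (eq i j)   s = s i ≡ s j
holds B (neq i j)  s = s i ≢ s j

record AtEnum (τ : Vocab) : Set where
  field
    at    : ℕ → Atomic τ
    bound : ∀ n → All (λ i → i ≤ n) (vars (at n))
    onto  : ∀ φ → Σ ℕ λ n → at n ≡ φ
open AtEnum public

Diag : ∀ {τ} → AtEnum τ → Structure τ → ℕ → Set
Diag E B n = holds B (at E n) (λ i → i)

pullback : ∀ {τ} → (ℕ → ℕ) → Structure τ → Structure τ
interp (pullback g A) R xs = interp A R (Vec.map g xs)

_⊑_ : List ℕ → List ℕ → Set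
p ⊑ q = Σ (List ℕ) λ r → q ≡ p ++ r

_⊂_ : List ℕ → (ℕ → ℕ) → Set
p ⊂ g = p ≡ map g (upTo (length p))

lookupD : List ℕ → ℕ → ℕ
lookupD []       _       = 0
lookupD (x ∷ xs) zero    = x
lookupD (x ∷ xs) (suc n) = lookupD xs n

module Forcing {τ : Vocab} (E : AtEnum τ) (A : Structure τ) where

  frcA : List ℕ → NAtom → Set
  frcA p TT    = ⊤
  frcA p FF    = ⊥
  frcA p (D n) = All (λ i → i < length p) (vars (at E n))
               × holds A (at E n) (lookupD p)

  mutual
    frcσ : List ℕ → Shape → Set
    frcσ p (fin l)      = All (frcA p) l
    frcσ p (dis1 I f)   = Σ I λ i → All (frcA p) (f i)
    frcσ p (disα I f h) = Σ I λ i → frcσ p (f i) × frcπ p (h i)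

    -- (π , s) is forced iff no extension forces neg (π , s) = (σ , s)
    frcπ : List ℕ → Shape → Set
    frcπ p s = ¬ (Σ (List ℕ) λ q → Unique q × p ⊑ q × frcσ q s)

  -- p ⊩_𝒜 φ   (conditions p are lists of distinct naturals)
  _⊩_ : List ℕ → NForm → Set
  p ⊩ (σ , s) = frcσ p s
  p ⊩ (π , s) = frcπ p s

  Generic : (ℕ → ℕ) → Set
  Generic g = Bijective _≡_ _≡_ g
            × (∀ b a i (d : CF b a i) → Σ (List ℕ) λ p → p ⊂ g
                 × (p ⊩ formula d ⊎ p ⊩ neg (formula d)))

{-# OPTIONS --safe #-}

-- Atoms transfer between
-- 𝒜 and 𝒢 = g⁻¹(𝒜) because p is an initial segment of g, and a true atom is
-- forced by every long enough initial segment. For Π-formulas genericity is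
-- used on the subformulas: each is decided by some p ⊂ g, and if the decisions
-- were the wrong way round, a common extension along g would force neg φ.
-- Completeness then follows, since g decides φ, and forcing neg φ would make
-- neg φ true.

module Submission where

open import Defs
open import Data.Nat using (ℕ; zero; suc; _≤_; _<_; _≤′_; ≤′-refl; ≤′-step; _⊔_; _+_; s≤s)
open import Data.Nat.Properties
  using (≤-trans; ≤⇒≤′; m≤m+n; m≤n+m; m+n≤o⇒m≤o; m+n≤o⇒n≤o; m≤m⊔n; m≤n⊔m)
open import Data.List using (List; []; _∷_; [_]; length; _++_; map; upTo; applyUpTo; _∷ʳ_)
open import Data.Nat.ListAction using (sum)
open import Data.List.Properties using (length-map; length-upTo; map-upTo; upTo-∷ʳ; map-++; ++-assoc; ++-identityʳ)
open import Data.List.Relation.Unary.All using (All; []; _∷_)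
import Data.List.Relation.Unary.All as All
open import Data.List.Relation.Unary.All.Properties using (¬All⇒Any¬; Any¬⇒¬All)
open import Data.List.Relation.Unary.Unique.Propositional using (Unique)
import Data.List.Relation.Unary.Unique.Propositional.Properties as Unique
open import Data.Vec using (Vec; toList)
import Data.Vec as Vec
import Data.Vec.Properties as Vec
open import Data.Product using (Σ; _×_; _,_; proj₁; proj₂)
open import Data.Sum using (_⊎_; inj₁; inj₂; swap)
open import Data.Unit using (tt)
open import Data.Empty using (⊥-elim)
open import Function using (_∘_; id)
open import Function.Definitions using (Injective)
open import Function.Bundles using (_⇔_; mk⇔; Equivalence)
open import Relation.Nullary using (¬_; yes; no)
open import Relation.Unary using (Decidable)
open import Relation.Binary.PropositionalEquality using (_≡_; refl; sym; trans; cong; cong₂; subst; module ≡-Reasoning)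

⊑-refl : ∀ {p} → p ⊑ p
⊑-refl {p} = [] , sym (++-identityʳ p)

⊑-trans : ∀ {p q r} → p ⊑ q → q ⊑ r → p ⊑ r
⊑-trans {p} (a , q≡p++a) (b , r≡q++b) =
  a ++ b , trans r≡q++b (trans (cong (_++ b) q≡p++a) (++-assoc p a b))

lookupD-applyUpTo : ∀ f n i → i < n → lookupD (applyUpTo f n) i ≡ f i
lookupD-applyUpTo f (suc n) zero    _         = refl
lookupD-applyUpTo f (suc n) (suc i) (s≤s i<n) = lookupD-applyUpTo (f ∘ suc) n i i<n

module Segments (g : ℕ → ℕ) where

  segment : ℕ → List ℕ
  segment n = map g (upTo n)

  length-segment : ∀ n → length (segment n) ≡ n
  length-segment n = trans (length-map g (upTo n)) (length-upTo n)

  segment-⊂ : ∀ n → segment n ⊂ g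
  segment-⊂ n = cong segment (sym (length-segment n))

  lookupD-⊂ : ∀ {p} → p ⊂ g → ∀ {i} → i < length p → lookupD p i ≡ g i
  lookupD-⊂ {p} p⊂g {i} i<∣p∣ = begin
    lookupD p i                           ≡⟨ cong (λ q → lookupD q i) p⊂g ⟩
    lookupD (segment (length p)) i        ≡⟨ cong (λ q → lookupD q i) (map-upTo g (length p)) ⟩
    lookupD (applyUpTo g (length p)) i    ≡⟨ lookupD-applyUpTo g (length p) i i<∣p∣ ⟩
    g i                                   ∎
    where open ≡-Reasoning

  segment-suc : ∀ n → segment (suc n) ≡ segment n ++ [ g n ]
  segment-suc n = begin
    map g (upTo (suc n))        ≡⟨ cong (map g) (sym (upTo-∷ʳ n)) ⟩
    map g (upTo n ∷ʳ n)         ≡⟨ map-++ g (upTo n) [ n ] ⟩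
    segment n ++ [ g n ]        ∎
    where open ≡-Reasoning

  segment-⊑′ : ∀ {m n} → m ≤′ n → segment m ⊑ segment n
  segment-⊑′ ≤′-refl            = ⊑-refl
  segment-⊑′ (≤′-step {n} m≤′n) = ⊑-trans (segment-⊑′ m≤′n) ([ g n ] , segment-suc n)

  ⊂⇒⊑segment : ∀ {p} → p ⊂ g → ∀ {N} → length p ≤ N → p ⊑ segment N
  ⊂⇒⊑segment p⊂g ∣p∣≤N = subst (_⊑ _) (sym p⊂g) (segment-⊑′ (≤⇒≤′ ∣p∣≤N))

  unique-segment : Injective _≡_ _≡_ g → ∀ n → Unique (segment n)
  unique-segment g-inj n = Unique.map⁺ g-inj (Unique.upTo⁺ n)

map-cong-toList : ∀ {n} {s t : ℕ → ℕ} (xs : Vec ℕ n)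
                → All (λ i → s i ≡ t i) (toList xs) → Vec.map s xs ≡ Vec.map t xs
map-cong-toList Vec.[]       []       = refl
map-cong-toList (x Vec.∷ xs) (e ∷ es) = cong₂ Vec._∷_ e (map-cong-toList xs es)

module _ {τ : Vocab} (B : Structure τ) where

  holds-cong : ∀ φ {s t : ℕ → ℕ} → All (λ i → s i ≡ t i) (vars φ) → holds B φ s → holds B φ t
  holds-cong (rel R xs) es             h   = subst (interp B R) (map-cong-toList xs es) h
  holds-cong (eq i j)   (ei ∷ ej ∷ []) h   = trans (sym ei) (trans h ej)
  holds-cong (neq i j)  (ei ∷ ej ∷ []) h e = h (trans ei (trans e (sym ej)))

  holds-pullback : ∀ {g} → Injective _≡_ _≡_ g → ∀ φ s
                 → holds (pullback g B) φ s ⇔ holds B φ (g ∘ s)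
  holds-pullback {g} g-inj (rel R xs) s =
    mk⇔ (subst (interp B R) (sym (Vec.map-∘ g s xs)))
        (subst (interp B R) (Vec.map-∘ g s xs))
  holds-pullback {g} g-inj (eq i j)  s = mk⇔ (cong g) g-inj
  holds-pullback {g} g-inj (neq i j) s = mk⇔ (λ h → h ∘ g-inj) (λ h → h ∘ cong g)

sat-σ-π-exclusive : ∀ X s → sat X σ s → ¬ sat X π s
sat-σ-π-exclusive X (fin l)    all       any  = Any¬⇒¬All any all
sat-σ-π-exclusive X (dis1 I f) (i , all) ∀any = Any¬⇒¬All (∀any i) all
sat-σ-π-exclusive X (disα I F H) (i , φ , θ) ∀or with ∀or i
... | inj₁ ¬φ = sat-σ-π-exclusive X (F i) φ ¬φ
... | inj₂ ¬θ = sat-σ-π-exclusive X (H i) ¬θ θ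

⊨-neg-exclusive : ∀ X φ → X ⊨ φ → ¬ (X ⊨ neg φ)
⊨-neg-exclusive X (σ , s) φ ¬φ = sat-σ-π-exclusive X s φ ¬φ
⊨-neg-exclusive X (π , s) φ ¬φ = sat-σ-π-exclusive X s ¬φ φ

module Forcing-⊑ {τ : Vocab} (E : AtEnum τ) (A : Structure τ) where
  open Forcing E A

  frcπ-⊑ : ∀ {p q} s → p ⊑ q → frcπ p s → frcπ q s
  frcπ-⊑ s p⊑q ¬ext (r , r-unique , q⊑r , r⊩s) = ¬ext (r , r-unique , ⊑-trans p⊑q q⊑r , r⊩s)

module AlongInjective {τ : Vocab} (E : AtEnum τ) (A : Structure τ)
                      {g : ℕ → ℕ} (g-inj : Injective _≡_ _≡_ g) where
  open Forcing E A
  open Forcing-⊑ E A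
  open Segments g

  X : ℕ → Set
  X = Diag E (pullback g A)

  InRange : List ℕ → ℕ → Set
  InRange p n = All (_< length p) (vars (at E n))

  X⇔holds-g : ∀ n → X n ⇔ holds A (at E n) g
  X⇔holds-g n = holds-pullback A g-inj (at E n) id

  forced-atom⇒true : ∀ {p} → p ⊂ g → ∀ {a} → frcA p a → satA X a
  forced-atom⇒true p⊂g {TT}  _              = tt
  forced-atom⇒true p⊂g {D n} (in-range , h) =
    Equivalence.from (X⇔holds-g n) (holds-cong A (at E n) (All.map (lookupD-⊂ p⊂g) in-range) h)

  true-atom⇒forced : ∀ {p} → p ⊂ g → ∀ {n} → InRange p n → X n → frcA p (D n)
  true-atom⇒forced p⊂g {n} in-range x =
    in-range ,
    holds-cong A (at E n) (All.map (λ i<∣p∣ → sym (lookupD-⊂ p⊂g i<∣p∣)) in-range) (Equivalence.to (X⇔holds-g n) x)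

  <-length-segment : ∀ {i N} → i < N → i < length (segment N)
  <-length-segment {N = N} = subst (_ <_) (sym (length-segment N))

  width : NAtom → ℕ
  width (D n) = suc n
  width _     = 0

  true-atom⇒forced-segment : ∀ {a N} → width a ≤ N → satA X a → frcA (segment N) a
  true-atom⇒forced-segment {TT}      _   _ = tt
  true-atom⇒forced-segment {D n} {N} n<N x =
    true-atom⇒forced (segment-⊂ N) (All.map (λ i≤n → <-length-segment (≤-trans (s≤s i≤n) n<N)) (bound E n)) x

  true-Σ₀⇒forced-segment : ∀ {l N} → sum (map width l) ≤ N → All (satA X) l → All (frcA (segment N)) l
  true-Σ₀⇒forced-segment         _  []       = []
  true-Σ₀⇒forced-segment {a ∷ _} ≤N (x ∷ xs) =
    true-atom⇒forced-segment (m+n≤o⇒m≤o (width a) ≤N) x ∷ true-Σ₀⇒forced-segment (m+n≤o⇒n≤o (width a) ≤N) xs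

  unforceable-Σ₀⇒¬true : ∀ {p} → p ⊂ g → ∀ l → frcπ p (fin l) → ¬ All (satA X) l
  unforceable-Σ₀⇒¬true {p} p⊂g l ¬ext true =
    ¬ext (segment N , unique-segment g-inj N , ⊂⇒⊑segment p⊂g (m≤m+n _ _) ,
          true-Σ₀⇒forced-segment (m≤n+m _ _) true)
    where N = length p + sum (map width l)

  frcA-along-g : ∀ {p} → p ⊂ g → ∀ {N} → length p ≤ N → ∀ {a} → frcA p a → frcA (segment N) a
  frcA-along-g p⊂g     ∣p∣≤N {TT}  _                      = tt
  frcA-along-g p⊂g {N} ∣p∣≤N {D n} forced@(in-range , _) =
    true-atom⇒forced (segment-⊂ N) (All.map (λ i<∣p∣ → <-length-segment (≤-trans i<∣p∣ ∣p∣≤N)) in-range)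
                     (forced-atom⇒true p⊂g forced)

  frcσ-along-g : ∀ {p} → p ⊂ g → ∀ {N} → length p ≤ N → ∀ s → frcσ p s → frcσ (segment N) s
  frcσ-along-g p⊂g ∣p∣≤N (fin l)      forced          = All.map (frcA-along-g p⊂g ∣p∣≤N) forced
  frcσ-along-g p⊂g ∣p∣≤N (dis1 I f)   (i , forced)    = i , All.map (frcA-along-g p⊂g ∣p∣≤N) forced
  frcσ-along-g p⊂g ∣p∣≤N (disα I F H) (i , p⊩F , p⊩H) =
    i , frcσ-along-g p⊂g ∣p∣≤N (F i) p⊩F , frcπ-⊑ (H i) (⊂⇒⊑segment p⊂g ∣p∣≤N) p⊩H

module TruthLemma {τ : Vocab} (E : AtEnum τ) (A : Structure τ)
                  {g : ℕ → ℕ} (gen : Forcing.Generic E A g) where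
  open Forcing E A
  open Forcing-⊑ E A
  open Segments g

  g-inj : Injective _≡_ _≡_ g
  g-inj = proj₁ (proj₁ gen)

  open AlongInjective E A g-inj public

  decides : ∀ {b a i} (d : CF b a i)
          → Σ (List ℕ) λ p → p ⊂ g × (p ⊩ formula d ⊎ p ⊩ neg (formula d))
  decides d = proj₂ gen _ _ _ d

  satA-dec : Decidable (satA X)
  satA-dec TT    = yes tt
  satA-dec FF    = no (λ ())
  satA-dec (D n) with decides (cf0 σ [ D n ])
  ... | p , p⊂g , inj₁ (forced ∷ []) = yes (forced-atom⇒true p⊂g forced)
  ... | p , p⊂g , inj₂ ¬ext          = no (λ x → unforceable-Σ₀⇒¬true p⊂g [ D n ] ¬ext (x ∷ []))

  Sound : Shape → Set
  Sound s = ∀ b {p} → p ⊂ g → p ⊩ (b , s) → X ⊨ (b , s)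

  Decided : Shape → Set
  Decided s = Σ (List ℕ) λ p → p ⊂ g × (frcσ p s ⊎ frcπ p s)

  decided : ∀ {b a i} (d : CF b a i) → Decided ⟦ d ⟧
  decided {σ} d = decides d
  decided {π} d with decides d
  ... | p , p⊂g , p⊩ = p , p⊂g , swap p⊩

  fin-sound : ∀ l → Sound (fin l)
  fin-sound l σ p⊂g forced = All.map (forced-atom⇒true p⊂g) forced
  fin-sound l π p⊂g ¬ext   = ¬All⇒Any¬ satA-dec l (unforceable-Σ₀⇒¬true p⊂g l ¬ext)

  dis1-sound : ∀ I f → Sound (dis1 I f)
  dis1-sound I f σ p⊂g (i , forced) = i , fin-sound (f i) σ p⊂g forced
  dis1-sound I f π p⊂g ¬ext i       =
    fin-sound (f i) π p⊂g (λ (q , q-unique , p⊑q , q⊩) → ¬ext (q , q-unique , p⊑q , i , q⊩))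

  disα-sound : ∀ I F H → (∀ i → Sound (F i)) → (∀ i → Sound (H i))
             → (∀ i → Decided (F i)) → (∀ i → Decided (H i)) → Sound (disα I F H)
  disα-sound I F H sF sH dF dH σ p⊂g (i , p⊩F , p⊩H) = i , sF i σ p⊂g p⊩F , sH i π p⊂g p⊩H
  disα-sound I F H sF sH dF dH π {p} p⊂g ¬ext i with dH i | dF i
  ... | q , q⊂g , inj₁ q⊩σH | _                   = inj₂ (sH i σ q⊂g q⊩σH)
  ... | _                   | r , r⊂g , inj₂ r⊩πF = inj₁ (sF i π r⊂g r⊩πF)
  ... | q , q⊂g , inj₂ q⊩πH | r , r⊂g , inj₁ r⊩σF =
    ⊥-elim (¬ext (segment N , unique-segment g-inj N , ⊂⇒⊑segment p⊂g ∣p∣≤N ,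
                  i , frcσ-along-g r⊂g ∣r∣≤N (F i) r⊩σF , frcπ-⊑ (H i) (⊂⇒⊑segment q⊂g ∣q∣≤N) q⊩πH))
    where
    N = length p ⊔ length q ⊔ length r
    ∣p∣≤N : length p ≤ N
    ∣p∣≤N = ≤-trans (m≤m⊔n (length p) (length q)) (m≤m⊔n _ (length r))
    ∣q∣≤N : length q ≤ N
    ∣q∣≤N = ≤-trans (m≤n⊔m (length p) (length q)) (m≤m⊔n _ (length r))
    ∣r∣≤N : length r ≤ N
    ∣r∣≤N = m≤n⊔m (length p ⊔ length q) (length r)

  forcing-sound : ∀ {b a i} (d : CF b a i) → Sound ⟦ d ⟧
  forcing-sound (cf0 _ l)       = fin-sound l
  forcing-sound (cf1 _ _ _ _)   = dis1-sound _ _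
  forcing-sound (cfα σ _ _ _ _ _ _ _ _ _ _ dΣ dΠ) =
    disα-sound _ _ _ (λ (j , w) → forcing-sound (dΣ j w)) (λ (j , w) → forcing-sound (dΠ j w))
                     (λ (j , w) → decided (dΣ j w))       (λ (j , w) → decided (dΠ j w))
  forcing-sound (cfα π _ _ _ _ _ _ _ _ _ _ dΣ dΠ) =
    disα-sound _ _ _ (λ (j , w) → forcing-sound (dΠ j w)) (λ (j , w) → forcing-sound (dΣ j w))
                     (λ (j , w) → decided (dΠ j w))       (λ (j , w) → decided (dΣ j w))

mainTheorem10 : (τ : Vocab) (E : AtEnum τ) (A : Structure τ) (g : ℕ → ℕ)
    → Forcing.Generic E A g
    → ∀ b a i (d : CF b a i)
    → (Diag E (pullback g A) ⊨ formula d)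
      ⇔ (Σ (List ℕ) λ p → p ⊂ g × Forcing._⊩_ E A p (formula d))
mainTheorem10 τ E A g gen b a i d = mk⇔ complete sound
  where
  open TruthLemma E A gen

  sound : (Σ (List ℕ) λ p → p ⊂ g × Forcing._⊩_ E A p (formula d)) → X ⊨ formula d
  sound (p , p⊂g , p⊩φ) = forcing-sound d b p⊂g p⊩φ

  complete : X ⊨ formula d → Σ (List ℕ) λ p → p ⊂ g × Forcing._⊩_ E A p (formula d)
  complete true with decides d
  ... | p , p⊂g , inj₁ p⊩φ  = p , p⊂g , p⊩φ
  ... | p , p⊂g , inj₂ p⊩¬φ =
    ⊥-elim (⊨-neg-exclusive X (formula d) true (forcing-sound d (flip b) p⊂g p⊩¬φ))
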